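{- Let $n\ge 1$ and $m\ge 1$ be integers with $m\equiv 1 \pmod n$. Then there exists a U-cycle of the set of equitable $m$-letter words on $[n]=\{1,\dots,n\}$.
   Context: An $m$-letter word on $[n]$ is a string $w_1\cdots w_m$ with each $w_i\in[n]$. For a letter $i$, let $|i|$ denote the number of occurrences of $i$ in the word. The word is equitable if $\big||i|-|j|\big|\le 1$ for all letters $i,j\in[n]$. Given a finite nonempty set $W$ of words of length $m$, a U-cycle for $W$ is a cyclic sequence $x_0x_1\cdots x_{N-1}$ with $N=|W|$ such that the $N$ windows $x_ix_{i+1}\cdots x_{i+m-1}$ (indices modulo $N$), $i=0,\dots,N-1$, are exactly the elements of $W$, each occurring exactly once. -}

module Defs where

open import Data.Nat using (ℕ; zero; suc; _+_; _≤_; _%_)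
open import Data.Nat.DivMod using (m%n<n)
open import Data.Fin using (Fin; toℕ; fromℕ<)
open import Data.Fin.Properties using (_≟_)
open import Data.Vec using (Vec; tabulate)
open import Data.Vec.Functional using () renaming (Vector to FVec)
open import Data.List using (List; length; filter)
open import Data.Vec using (toList)
open import Data.Product using (Σ; ∃; _×_; _,_)
open import Relation.Binary.PropositionalEquality using (_≡_)

-- An m-letter word on [n] (letters are Fin n, i.e. {0,…,n-1} ≅ {1,…,n}).
Word : ℕ → ℕ → Set
Word m n = Vec (Fin n) m

occ : ∀ {m n} → Fin n → Word m n → ℕ
occ i w = length (filter (_≟ i) (toList w))

-- equitable: ||i| - |j|| ≤ 1 for all letters i, j
-- (stated symmetrically as |i| ≤ |j| + 1 for all ordered pairs)
Equitable : ∀ {m n} → Word m n → Set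
Equitable {m} {n} w = (i j : Fin n) → occ i w ≤ suc (occ j w)

-- the cyclic sequence x₀…x_{N-1} with N = suc N' (nonempty);
-- window i = x_i x_{i+1} … x_{i+m-1}, indices mod N
window : ∀ {N' n} (m : ℕ) → (Fin (suc N') → Fin n) → Fin (suc N') → Word m n
window {N'} m x i =
  tabulate (λ k → x (fromℕ< (m%n<n (toℕ i + toℕ k) (suc N'))))

-- x is a U-cycle for the set W ⊆ Word m n given by predicate P:
-- every window lies in W, distinct positions give distinct windows,
-- and every element of W occurs as a window. Hence N = |W|.
IsUCycle : ∀ {N' n} (m : ℕ) → (Word m n → Set) → (Fin (suc N') → Fin n) → Set
IsUCycle {N'} m P x =
  ((i : Fin (suc N')) → P (window m x i)) ×
  ((i j : Fin (suc N')) → window m x i ≡ window m x j → i ≡ j) ×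
  ((w : Word _ _) → P w → ∃ λ i → window m x i ≡ w)

HasUCycle : ∀ {n} (m : ℕ) → (Word m n → Set) → Set
HasUCycle {n} m P = ∃ λ N' → Σ (Fin (suc N') → Fin n) λ x → IsUCycle m P x

-- Write m = qn + 1; an equitable m-word has one letter occurring q + 1 times and every other
-- letter q times. Take the equitable m-words as the edges of a multigraph on (m − 1)-words, w going
-- from init w to tail w: a U-cycle is an Eulerian circuit, read off by first letters. The rotation
-- x ∷ v ↦ v ∷ʳ x permutes the equitable words and turns tails into inits, so the graph is balanced.
-- It is connected: dropping the first letter and appending it again rotates a word, and when the
-- dropped letter is the surplus one any letter may be appended; together these realise every
-- adjacent transposition, hence every rearrangement, and any change of the surplus letter.
-- Hierholzer's splicing then yields the circuit.

module Submission where

open import Data.Nat using (ℕ; zero; suc; _+_; _*_; _%_; _/_; _≤_; _<_; _≥_; _≤?_; z≤n; s≤s; NonZero)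
open import Data.Nat.DivMod using (m%n<n; m<n⇒m%n≡m; n%n≡0; %-distribˡ-+; m%n%n≡m%n; m≡m%n+[m/n]*n)
open import Data.Nat.Induction using (<-wellFounded)
open import Data.Nat.Properties
  using (+-identityʳ; +-assoc; +-comm; *-comm; *-zeroʳ; *-identityʳ; suc-injective; ≤-reflexive; ≤-refl; ≤-trans;
         <-≤-trans; <⇒≱; m≤n+m; m≤m+n; +-mono-≤; +-monoʳ-≤; +-mono-<-≤; +-cancelˡ-≡; +-cancelʳ-≡; +-cancelˡ-≤;
         m≤n⇒m<n∨m≡n; m<1+n⇒m≤n; *-cancelˡ-<; module ≤-Reasoning)
open import Data.Nat.Tactic.RingSolver using (solve-∀)
open import Data.Fin using (Fin; zero; suc; toℕ; fromℕ<; inject₁)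
open import Data.Fin.Properties using (_≟_; all?; toℕ-fromℕ<; toℕ-injective; toℕ<n; toℕ-inject₁)
import Data.Fin.Properties as Fin using (suc-injective)
open import Data.Vec as Vec using (Vec; []; _∷_; head; tail; init; last; toList; tabulate; initLast; _∷ʳ_)
open import Data.Vec.Properties
  using (tabulate-cong; tabulate∘lookup; toList-injective; cast-is-id; toList-∷ʳ; toList-++; init-∷ʳ; ∷-injective;
         ∷ʳ-injective; length-toList)
  renaming (≡-dec to ≡-decᵛ)
open import Data.List as List using (List; []; _∷_; _++_; [_]; map; length; filter; lookup; allFin; cartesianProductWith)
open import Data.List.Properties
  using (map-++; map-∘; map-cong; ++-assoc; ++-identityʳ; length-++; filter-++; filter-accept; filter-reject; length-filter)
open import Data.List.Extrema.Nat using (argmax; f[xs]≤f[argmax])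
open import Data.List.Membership.Propositional using (_∈_; _∉_)
open import Data.List.Membership.Propositional.Properties
  using (∈-map⁺; ∈-map⁻; ∈-++⁺ˡ; ∈-++⁺ʳ; ∈-++⁻; ∈-∃++; ∈-filter⁺; ∈-filter⁻; ∈-lookup; ∈-allFin; ∈-cartesianProductWith⁺)
import Data.List.Relation.Unary.All as All
open import Data.List.Relation.Unary.Any using (here; there; index)
open import Data.List.Relation.Unary.Any.Properties using (lookup-index)
open import Data.List.Relation.Unary.Unique.Propositional using (Unique; []; _∷_)
import Data.List.Relation.Unary.Unique.Propositional.Properties as Unique
open import Data.List.Relation.Binary.Permutation.Propositional
  using (_↭_; ↭-refl; ↭-prep; ↭-swap; ↭-sym; ↭-trans; ↭-reflexive; ↭⇒↭ₛ; module PermutationReasoning)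
import Data.List.Relation.Binary.Permutation.Propositional as Perm
open import Data.List.Relation.Binary.Permutation.Propositional.Properties
  using (map⁺; ++⁺ˡ; ++⁺ʳ; shift; shifts; drop-∷; ∷↭∷ʳ; ∈-resp-↭; ↭-length; ++-comm; filter-↭)
import Data.List.Relation.Binary.Permutation.Setoid.Properties as PermutationₛProperties
open import Data.Product using (Σ; ∃; ∃₂; _×_; _,_; proj₂)
open import Data.Sum using (_⊎_; inj₁; inj₂)
open import Function using (_∘_; id)
open import Induction.WellFounded using (Acc; acc)
open import Relation.Binary.Construct.Closure.ReflexiveTransitive using (Star; ε; _◅_; _◅◅_)
open import Relation.Binary.Construct.Closure.ReflexiveTransitive.Properties using (module StarReasoning)
open import Relation.Binary.Definitions using (DecidableEquality)
open import Relation.Binary.PropositionalEquality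
  using (_≡_; _≢_; _≗_; refl; sym; trans; cong; cong₂; subst; subst₂; setoid; module ≡-Reasoning)
open import Relation.Nullary using (Dec; yes; no; contradiction)

open import Defs

-- Lists up to permutation

++-cancelˡ-↭ : ∀ {A : Set} (xs : List A) {ys zs} → xs ++ ys ↭ xs ++ zs → ys ↭ zs
++-cancelˡ-↭ []       p = p
++-cancelˡ-↭ (x ∷ xs) p = ++-cancelˡ-↭ xs (drop-∷ p)

Unique-resp-↭ : ∀ {A : Set} {xs ys : List A} → xs ↭ ys → Unique xs → Unique ys
Unique-resp-↭ {A} p = PermutationₛProperties.Unique-resp-↭ (setoid A) (↭⇒↭ₛ p)

Unique[xs++y∷ys]⇒y∉xs : ∀ {A : Set} xs {y : A} {ys} → Unique (xs ++ y ∷ ys) → y ∉ xs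
Unique[xs++y∷ys]⇒y∉xs xs {y} {ys} u y∈xs =
  Unique.Unique[x∷xs]⇒x∉xs (Unique-resp-↭ (shift y xs ys) u) (∈-++⁺ˡ y∈xs)

Unique-⊆-antisym⇒↭ : ∀ {A : Set} {xs ys : List A} → Unique xs → Unique ys →
                     (∀ {z} → z ∈ xs → z ∈ ys) → (∀ {z} → z ∈ ys → z ∈ xs) → xs ↭ ys
Unique-⊆-antisym⇒↭ {xs = []} {[]}     _ _ _ _ = ↭-refl
Unique-⊆-antisym⇒↭ {xs = []} {y ∷ _}  _ _ _ ys⊆xs with () ← ys⊆xs (here refl)
Unique-⊆-antisym⇒↭ {xs = x ∷ xs} {ys} (x∉xs ∷ unique-xs) unique-ys xs⊆ys ys⊆xs
  with ys₁ , ys₂ , refl ← ∈-∃++ (xs⊆ys (here refl))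
  = ↭-trans (↭-prep x (Unique-⊆-antisym⇒↭ unique-xs unique-rest sub sup)) (↭-sym (shift x ys₁ ys₂))
  where
  unique-x∷rest : Unique (x ∷ ys₁ ++ ys₂)
  unique-x∷rest = Unique-resp-↭ (shift x ys₁ ys₂) unique-ys
  unique-rest : Unique (ys₁ ++ ys₂)
  unique-rest with _ ∷ u ← unique-x∷rest = u
  sub : ∀ {z} → z ∈ xs → z ∈ ys₁ ++ ys₂
  sub z∈xs with ∈-resp-↭ (shift x ys₁ ys₂) (xs⊆ys (there z∈xs))
  ... | here refl = contradiction z∈xs (Unique.Unique[x∷xs]⇒x∉xs (x∉xs ∷ unique-xs))
  ... | there z∈rest = z∈rest
  sup : ∀ {z} → z ∈ ys₁ ++ ys₂ → z ∈ xs
  sup z∈rest with ys⊆xs (∈-resp-↭ (↭-sym (shift x ys₁ ys₂)) (there z∈rest))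
  ... | here refl = contradiction z∈rest (Unique.Unique[x∷xs]⇒x∉xs unique-x∷rest)
  ... | there z∈xs = z∈xs

lookup-injective : ∀ {A : Set} {xs : List A} → Unique xs → ∀ i j → lookup xs i ≡ lookup xs j → i ≡ j
lookup-injective (_ ∷ _)      zero    zero    _  = refl
lookup-injective (x∉xs ∷ _)   zero    (suc j) eq = contradiction eq (All.lookup x∉xs (∈-lookup j))
lookup-injective (x∉xs ∷ _)   (suc i) zero    eq = contradiction (sym eq) (All.lookup x∉xs (∈-lookup i))
lookup-injective (_ ∷ unique) (suc i) (suc j) eq = cong suc (lookup-injective unique i j eq)

-- Cyclic indices and windows

-- Defs.window reads position i + k of a cyclic sequence as i ⊕ k.
_⊕_ : ∀ {N′} → Fin (suc N′) → ℕ → Fin (suc N′)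
_⊕_ {N′} i k = fromℕ< (m%n<n (toℕ i + k) (suc N′))

module _ {N′ : ℕ} where

  private
    N = suc N′

  toℕ-⊕ : ∀ (i : Fin N) k → toℕ (i ⊕ k) ≡ (toℕ i + k) % N
  toℕ-⊕ i k = toℕ-fromℕ< (m%n<n (toℕ i + k) N)

  ⊕-identityʳ : ∀ (i : Fin N) → i ⊕ 0 ≡ i
  ⊕-identityʳ i = toℕ-injective (begin
    toℕ (i ⊕ 0)        ≡⟨ toℕ-⊕ i 0 ⟩
    (toℕ i + 0) % N    ≡⟨ cong (_% N) (+-identityʳ (toℕ i)) ⟩
    toℕ i % N          ≡⟨ m<n⇒m%n≡m (toℕ<n i) ⟩
    toℕ i              ∎)
    where open ≡-Reasoning

  ⊕-suc : ∀ (i : Fin N) k → (i ⊕ 1) ⊕ k ≡ i ⊕ suc k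
  ⊕-suc i k = toℕ-injective (begin
    toℕ ((i ⊕ 1) ⊕ k)                 ≡⟨ toℕ-⊕ (i ⊕ 1) k ⟩
    (toℕ (i ⊕ 1) + k) % N             ≡⟨ cong (λ t → (t + k) % N) (toℕ-⊕ i 1) ⟩
    ((toℕ i + 1) % N + k) % N         ≡⟨ %-distribˡ-+ ((toℕ i + 1) % N) k N ⟩
    ((toℕ i + 1) % N % N + k % N) % N ≡⟨ cong (λ t → (t + k % N) % N) (m%n%n≡m%n (toℕ i + 1) N) ⟩
    ((toℕ i + 1) % N + k % N) % N     ≡⟨ %-distribˡ-+ (toℕ i + 1) k N ⟨
    (toℕ i + 1 + k) % N               ≡⟨ cong (_% N) (+-assoc (toℕ i) 1 k) ⟩
    (toℕ i + suc k) % N               ≡⟨ toℕ-⊕ i (suc k) ⟨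
    toℕ (i ⊕ suc k)                   ∎)
    where open ≡-Reasoning

lookup-zero : ∀ {A : Set} {k} (v : Vec A (suc k)) → Vec.lookup v zero ≡ head v
lookup-zero (x ∷ v) = refl

lookup-suc : ∀ {A : Set} {k} (v : Vec A (suc k)) (j : Fin k) → Vec.lookup v (suc j) ≡ Vec.lookup (tail v) j
lookup-suc (x ∷ v) j = refl

lookup-init : ∀ {A : Set} {k} (v : Vec A (suc k)) (j : Fin k) → Vec.lookup (init v) j ≡ Vec.lookup v (inject₁ j)
lookup-init (x ∷ y ∷ v) zero    = refl
lookup-init (x ∷ y ∷ v) (suc j) = lookup-init (y ∷ v) j

windows-of-closed-walk : ∀ {N′ k n} (e : Fin (suc N′) → Word (suc k) n) →
                         (∀ i → tail (e i) ≡ init (e (i ⊕ 1))) →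
                         ∀ i → window (suc k) (head ∘ e) i ≡ e i
windows-of-closed-walk {k = k} e adjacent i =
  trans (tabulate-cong (λ j → sym (letter (toℕ j) i j refl))) (tabulate∘lookup (e i))
  where
  letter : ∀ d i (j : Fin (suc k)) → toℕ j ≡ d → Vec.lookup (e i) j ≡ head (e (i ⊕ d))
  letter zero    i zero    refl = trans (lookup-zero (e i)) (cong (head ∘ e) (sym (⊕-identityʳ i)))
  letter (suc d) i (suc j) eq   = begin
    Vec.lookup (e i) (suc j)              ≡⟨ lookup-suc (e i) j ⟩
    Vec.lookup (tail (e i)) j             ≡⟨ cong (λ v → Vec.lookup v j) (adjacent i) ⟩
    Vec.lookup (init (e (i ⊕ 1))) j       ≡⟨ lookup-init (e (i ⊕ 1)) j ⟩
    Vec.lookup (e (i ⊕ 1)) (inject₁ j)    ≡⟨ letter d (i ⊕ 1) (inject₁ j) (trans (toℕ-inject₁ j) (suc-injective eq)) ⟩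
    head (e ((i ⊕ 1) ⊕ d))            ≡⟨ cong (head ∘ e) (⊕-suc i d) ⟩
    head (e (i ⊕ suc d))              ∎
    where open ≡-Reasoning

closed-walk⇒UCycle : ∀ {N′ k n} {P : Word (suc k) n → Set} (e : Fin (suc N′) → Word (suc k) n) →
                     (∀ i → tail (e i) ≡ init (e (i ⊕ 1))) → (∀ i → P (e i)) →
                     (∀ i j → e i ≡ e j → i ≡ j) → (∀ w → P w → ∃ λ i → e i ≡ w) →
                     IsUCycle (suc k) P (head ∘ e)
closed-walk⇒UCycle {P = P} e adjacent P-e injective surjective =
  (λ i → subst P (sym (window≡e i)) (P-e i)) ,
  (λ i j windows≡ → injective i j (trans (sym (window≡e i)) (trans windows≡ (window≡e j)))) ,
  (λ w Pw → let i , eᵢ≡w = surjective w Pw in i , trans (window≡e i) eᵢ≡w)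
  where
  window≡e = windows-of-closed-walk e adjacent

-- Eulerian circuits

module Eulerian {E V : Set} (_≟ᵥ_ : DecidableEquality V) (src tgt : E → V) where

  data Trail : V → V → Set where
    []   : ∀ {v} → Trail v v
    step : ∀ {u w} (e : E) → src e ≡ u → Trail (tgt e) w → Trail u w

  edges : ∀ {u w} → Trail u w → List E
  edges []           = []
  edges (step e _ T) = e ∷ edges T

  _++ᵗ_ : ∀ {u v w} → Trail u v → Trail v w → Trail u w
  []           ++ᵗ T′ = T′
  (step e p T) ++ᵗ T′ = step e p (T ++ᵗ T′)

  edges-++ᵗ : ∀ {u v w} (T : Trail u v) (T′ : Trail v w) → edges (T ++ᵗ T′) ≡ edges T ++ edges T′
  edges-++ᵗ []           T′ = refl
  edges-++ᵗ (step e _ T) T′ = cong (e ∷_) (edges-++ᵗ T T′)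

  split-after : ∀ {u w} (T : Trail u w) {g} → g ∈ edges T →
                ∃₂ λ (P : Trail u (tgt g)) (Q : Trail (tgt g) w) → edges T ≡ edges P ++ edges Q
  split-after (step e p T) (here refl) = step e p [] , T , refl
  split-after (step e p T) (there g∈T) with P , Q , eq ← split-after T g∈T =
    step e p P , Q , cong (e ∷_) eq

  -- In-degree = out-degree everywhere, stated as an equality of endpoint multisets.
  Balanced : List E → Set
  Balanced es = map src es ↭ map tgt es

  Balanced-resp-↭ : ∀ {es es′} → es ↭ es′ → Balanced es → Balanced es′
  Balanced-resp-↭ p bal = ↭-trans (↭-sym (map⁺ src p)) (↭-trans bal (map⁺ tgt p))

  trail-vertices : ∀ {u w} (T : Trail u w) → map src (edges T) ++ [ w ] ≡ u ∷ map tgt (edges T)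
  trail-vertices []              = refl
  trail-vertices (step e refl T) = cong (src e ∷_) (trail-vertices T)

  closed-trail-balanced : ∀ {w} (T : Trail w w) → Balanced (edges T)
  closed-trail-balanced {w} T = drop-∷ (↭-trans (∷↭∷ʳ w (map src (edges T))) (↭-reflexive (trail-vertices T)))

  Balanced-++⁻ʳ : ∀ xs {ys} → Balanced xs → Balanced (xs ++ ys) → Balanced ys
  Balanced-++⁻ʳ xs {ys} balxs bal = ++-cancelˡ-↭ (map tgt xs) (begin
    map tgt xs ++ map src ys  ↭⟨ ++⁺ʳ (map src ys) (↭-sym balxs) ⟩
    map src xs ++ map src ys  ≡⟨ map-++ src xs ys ⟨
    map src (xs ++ ys)        ↭⟨ bal ⟩
    map tgt (xs ++ ys)        ≡⟨ map-++ tgt xs ys ⟩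
    map tgt xs ++ map tgt ys  ∎)
    where open PermutationReasoning

  -- Endpoints of P: sources ++ [ u ] = v ∷ targets, so balance leaves u ∷ targets R ↭ v ∷ sources R.
  exit-edge : ∀ {v u} (P : Trail v u) {R} → u ≢ v → Balanced (edges P ++ R) → ∃ λ g → g ∈ R × src g ≡ u
  exit-edge {v} {u} P {R} u≢v bal with ∈-map⁻ src u∈sources
    where
    S = map src (edges P)
    T = map tgt (edges P)
    u∷tR↭v∷sR : u ∷ map tgt R ↭ v ∷ map src R
    u∷tR↭v∷sR = ++-cancelˡ-↭ S (begin
      S ++ u ∷ map tgt R            ≡⟨ ++-assoc S [ u ] (map tgt R) ⟨
      (S ++ [ u ]) ++ map tgt R     ≡⟨ cong (_++ map tgt R) (trail-vertices P) ⟩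
      v ∷ T ++ map tgt R            ≡⟨ cong (v ∷_) (map-++ tgt (edges P) R) ⟨
      v ∷ map tgt (edges P ++ R)    ↭⟨ ↭-sym (↭-prep v bal) ⟩
      v ∷ map src (edges P ++ R)    ≡⟨ cong (v ∷_) (map-++ src (edges P) R) ⟩
      v ∷ S ++ map src R            ↭⟨ shift v S (map src R) ⟨
      S ++ v ∷ map src R            ∎)
      where open PermutationReasoning
    u∈sources : u ∈ map src R
    u∈sources with ∈-resp-↭ u∷tR↭v∷sR (here refl)
    ... | here u≡v   = contradiction u≡v u≢v
    ... | there u∈sR = u∈sR
  ... | g , g∈R , u≡sg = g , g∈R , sym u≡sg

  return-to-start : ∀ {v u} (P : Trail v u) R → Balanced (edges P ++ R) → Acc _<_ (length R) →
                    ∃₂ λ (Q : Trail u v) R′ → edges Q ++ R′ ↭ R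
  return-to-start {v} {u} P R bal (acc rs) with u ≟ᵥ v
  ... | yes refl = [] , R , ↭-refl
  ... | no u≢v with exit-edge P u≢v bal
  ... | g , g∈R , sg with ∈-∃++ g∈R
  ... | R₁ , R₂ , refl with return-to-start (P ++ᵗ step g sg []) (R₁ ++ R₂) bal′ (rs shorter)
    where
    shorter : length (R₁ ++ R₂) < length (R₁ ++ g ∷ R₂)
    shorter = ≤-reflexive (sym (↭-length (shift g R₁ R₂)))
    bal′ : Balanced (edges (P ++ᵗ step g sg []) ++ R₁ ++ R₂)
    bal′ = Balanced-resp-↭ (begin
      edges P ++ R₁ ++ g ∷ R₂               ↭⟨ ++⁺ˡ (edges P) (shift g R₁ R₂) ⟩
      edges P ++ g ∷ R₁ ++ R₂               ≡⟨ ++-assoc (edges P) [ g ] (R₁ ++ R₂) ⟨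
      (edges P ++ [ g ]) ++ R₁ ++ R₂        ≡⟨ cong (_++ R₁ ++ R₂) (edges-++ᵗ P (step g sg [])) ⟨
      edges (P ++ᵗ step g sg []) ++ R₁ ++ R₂ ∎) bal
      where open PermutationReasoning
  ... | Q , R′ , perm = step g sg Q , R′ , ↭-trans (↭-prep g perm) (↭-sym (shift g R₁ R₂))

  closed-trail-from : ∀ {x h R} → src h ≡ x → h ∈ R → Balanced R →
                      ∃₂ λ (Q : Trail (tgt h) x) R′ → h ∷ edges Q ++ R′ ↭ R
  closed-trail-from {h = h} sh h∈R bal with R₁ , R₂ , refl ← ∈-∃++ h∈R
    with Q , R′ , perm ←
           return-to-start (step h sh []) (R₁ ++ R₂) (Balanced-resp-↭ (shift h R₁ R₂) bal) (<-wellFounded _)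
    = Q , R′ , ↭-trans (↭-prep h perm) (↭-sym (shift h R₁ R₂))

  remainder-shorter : ∀ {h : E} {xs ys R} → h ∷ xs ++ ys ↭ R → length ys < length R
  remainder-shorter {xs = xs} {ys} p =
    ≤-trans (s≤s (m≤n+m (length ys) (length xs))) (≤-reflexive (trans (cong suc (sym (length-++ xs))) (↭-length p)))

  trail-consecutive : ∀ {u w} (T : Trail u w) (i j : Fin (length (edges T))) → toℕ j ≡ suc (toℕ i) →
                      tgt (lookup (edges T) i) ≡ src (lookup (edges T) j)
  trail-consecutive (step e _ (step e′ p′ T)) zero    (suc zero) refl = sym p′
  trail-consecutive (step e _ T)              (suc i) (suc j)    eq   = trail-consecutive T i j (suc-injective eq)

  trail-last : ∀ {u w} (T : Trail u w) (i : Fin (length (edges T))) → suc (toℕ i) ≡ length (edges T) →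
               tgt (lookup (edges T) i) ≡ w
  trail-last (step e _ [])  zero    refl = refl
  trail-last (step e _ T)   (suc i) eq   = trail-last T i (suc-injective eq)

  closed-trail-adjacent : ∀ {w e} (p : src e ≡ w) (T : Trail (tgt e) w) (i : Fin (length (edges (step e p T)))) →
                          tgt (lookup (edges (step e p T)) i) ≡ src (lookup (edges (step e p T)) (i ⊕ 1))
  closed-trail-adjacent {e = e} p T i with m≤n⇒m<n∨m≡n (toℕ<n i)
  ... | inj₁ i+1<N = trail-consecutive (step e p T) i (i ⊕ 1) (trans toℕ[i⊕1] (m<n⇒m%n≡m i+1<N))
    where
    toℕ[i⊕1] : toℕ (i ⊕ 1) ≡ suc (toℕ i) % suc (length (edges T))
    toℕ[i⊕1] = trans (toℕ-⊕ i 1) (cong (_% suc (length (edges T))) (+-comm (toℕ i) 1))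
  ... | inj₂ i+1≡N =
    trans (trail-last (step e p T) i i+1≡N) (sym (trans (cong (src ∘ lookup (e ∷ edges T)) i⊕1≡0) p))
    where
    i⊕1≡0 : i ⊕ 1 ≡ zero
    i⊕1≡0 = toℕ-injective (begin
      toℕ (i ⊕ 1)        ≡⟨ toℕ-⊕ i 1 ⟩
      (toℕ i + 1) % N    ≡⟨ cong (_% N) (trans (+-comm (toℕ i) 1) i+1≡N) ⟩
      N % N              ≡⟨ n%n≡0 N ⟩
      0                  ∎)
      where
      open ≡-Reasoning
      N = suc (length (edges T))

  Adjacent : List E → E → E → Set
  Adjacent all a b = tgt a ≡ src b × b ∈ all

  frontier : ∀ {all L R a c} → (∀ {b} → b ∈ all → b ∈ L ⊎ b ∈ R) →
             Star (Adjacent all) a c → a ∈ L → c ∉ L → ∃₂ λ g h → g ∈ L × h ∈ R × tgt g ≡ src h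
  frontier cover ε                    a∈L c∉L = contradiction a∈L c∉L
  frontier cover ((tgt≡src , b∈all) ◅ path) a∈L c∉L with cover b∈all
  ... | inj₁ b∈L = frontier cover path b∈L c∉L
  ... | inj₂ b∈R = _ , _ , a∈L , b∈R , tgt≡src

  edges-splice : ∀ {u v w} (P : Trail u v) (C : Trail v v) (Q : Trail v w) →
                 edges (P ++ᵗ (C ++ᵗ Q)) ≡ edges P ++ edges C ++ edges Q
  edges-splice P C Q = trans (edges-++ᵗ P (C ++ᵗ Q)) (cong (edges P ++_) (edges-++ᵗ C Q))

  module _ (all : List E) (unique : Unique all) (balanced : Balanced all)
           {e₀ : E} (connected : ∀ {e} → e ∈ all → Star (Adjacent all) e₀ e) where

    remaining-balanced : ∀ {w} (T : Trail w w) {R} → edges T ++ R ↭ all → Balanced R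
    remaining-balanced T perm =
      Balanced-++⁻ʳ (edges T) (closed-trail-balanced T) (Balanced-resp-↭ (↭-sym perm) balanced)

    -- Hierholzer: splice a closed trail of unused edges into T where T touches them.
    grow : ∀ {w} (T : Trail w w) R → edges T ++ R ↭ all → e₀ ∈ edges T → Acc _<_ (length R) →
           ∃ λ w′ → Σ (Trail w′ w′) λ T′ → edges T′ ↭ all
    grow {w} T [] perm _ _ = w , T , ↭-trans (↭-reflexive (sym (++-identityʳ (edges T)))) perm
    grow T (r ∷ R) perm e₀∈T (acc rs) with frontier cover (connected r∈all) e₀∈T r∉T
      where
      r∈all : r ∈ all
      r∈all = ∈-resp-↭ perm (∈-++⁺ʳ (edges T) (here refl))
      r∉T : r ∉ edges T
      r∉T = Unique[xs++y∷ys]⇒y∉xs (edges T) (Unique-resp-↭ (↭-sym perm) unique)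
      cover : ∀ {b} → b ∈ all → b ∈ edges T ⊎ b ∈ r ∷ R
      cover b∈all = ∈-++⁻ (edges T) (∈-resp-↭ (↭-sym perm) b∈all)
    ... | g , h , g∈T , h∈R , tg≡sh
      with P , Q , T≡PQ ← split-after T g∈T
      with C′ , R′ , permC ← closed-trail-from (sym tg≡sh) h∈R (remaining-balanced T perm)
      = grow (P ++ᵗ (C ++ᵗ Q)) R′ perm′ e₀∈T′ (rs (remainder-shorter {xs = edges C′} permC))
      where
      C = step h (sym tg≡sh) C′
      perm′ : edges (P ++ᵗ (C ++ᵗ Q)) ++ R′ ↭ all
      perm′ = begin
        edges (P ++ᵗ (C ++ᵗ Q)) ++ R′           ≡⟨ cong (_++ R′) (edges-splice P C Q) ⟩
        (edges P ++ edges C ++ edges Q) ++ R′   ≡⟨ ++-assoc (edges P) (edges C ++ edges Q) R′ ⟩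
        edges P ++ (edges C ++ edges Q) ++ R′   ≡⟨ cong (edges P ++_) (++-assoc (edges C) (edges Q) R′) ⟩
        edges P ++ edges C ++ edges Q ++ R′     ↭⟨ ++⁺ˡ (edges P) (shifts (edges C) (edges Q)) ⟩
        edges P ++ edges Q ++ edges C ++ R′     ↭⟨ ++⁺ˡ (edges P) (++⁺ˡ (edges Q) permC) ⟩
        edges P ++ edges Q ++ r ∷ R             ≡⟨ ++-assoc (edges P) (edges Q) (r ∷ R) ⟨
        (edges P ++ edges Q) ++ r ∷ R           ≡⟨ cong (_++ r ∷ R) T≡PQ ⟨
        edges T ++ r ∷ R                        ↭⟨ perm ⟩
        all                                     ∎
        where open PermutationReasoning
      e₀∈T′ : e₀ ∈ edges (P ++ᵗ (C ++ᵗ Q))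
      e₀∈T′ with ∈-++⁻ (edges P) (subst (e₀ ∈_) T≡PQ e₀∈T)
      ... | inj₁ e₀∈P = subst (e₀ ∈_) (sym (edges-splice P C Q)) (∈-++⁺ˡ e₀∈P)
      ... | inj₂ e₀∈Q = subst (e₀ ∈_) (sym (edges-splice P C Q)) (∈-++⁺ʳ (edges P) (∈-++⁺ʳ (edges C) e₀∈Q))

    eulerian-circuit : e₀ ∈ all → ∃ λ w → Σ (Trail w w) λ T → edges T ↭ all
    eulerian-circuit e₀∈all with Q , R , perm ← closed-trail-from refl e₀∈all balanced
      = grow (step e₀ refl Q) R perm (here refl) (<-wellFounded _)

-- Letter counts

count : ∀ {n} → Fin n → List (Fin n) → ℕ
count i xs = length (filter (_≟ i) xs)

module _ {n : ℕ} where

  count-++ : ∀ (i : Fin n) xs ys → count i (xs ++ ys) ≡ count i xs + count i ys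
  count-++ i xs ys = trans (cong length (filter-++ (_≟ i) xs ys)) (length-++ (filter (_≟ i) xs))

  count-↭ : ∀ (i : Fin n) {xs ys} → xs ↭ ys → count i xs ≡ count i ys
  count-↭ i p = ↭-length (filter-↭ (_≟ i) p)

  count-self : ∀ (i : Fin n) → count i [ i ] ≡ 1
  count-self i = cong length (filter-accept (_≟ i) refl)

  count-head : ∀ (x : Fin n) xs → count x (x ∷ xs) ≡ suc (count x xs)
  count-head x xs = cong length (filter-accept (_≟ x) refl)

  count-other : ∀ {i x : Fin n} → x ≢ i → count i [ x ] ≡ 0
  count-other {i} x≢i = cong length (filter-reject (_≟ i) x≢i)

  count-singleton≤1 : ∀ (i x : Fin n) → count i [ x ] ≤ 1
  count-singleton≤1 i x = length-filter (_≟ i) [ x ]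

  count-singleton-sym : ∀ (i x : Fin n) → count i [ x ] ≡ count x [ i ]
  count-singleton-sym i x = by-cases (x ≟ i)
    where
    by-cases : Dec (x ≡ i) → count i [ x ] ≡ count x [ i ]
    by-cases (yes refl) = refl
    by-cases (no x≢i)   = trans (count-other x≢i) (sym (count-other (x≢i ∘ sym)))

  count>0⇒∈ : ∀ {i : Fin n} xs → 0 < count i xs → i ∈ xs
  count>0⇒∈ {i} (x ∷ xs) pos = by-cases (x ≟ i)
    where
    by-cases : Dec (x ≡ i) → i ∈ x ∷ xs
    by-cases (yes refl) = here refl
    by-cases (no x≢i)   = there (count>0⇒∈ xs (subst (0 <_) count-tail pos))
      where
      count-tail : count i (x ∷ xs) ≡ count i xs
      count-tail = trans (count-++ i [ x ] xs) (cong (_+ count i xs) (count-other x≢i))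

  counts⇒↭ : ∀ (xs ys : List (Fin n)) → (∀ i → count i xs ≡ count i ys) → xs ↭ ys
  counts⇒↭ []       []       _    = ↭-refl
  counts⇒↭ []       (y ∷ ys) same with () ← trans (same y) (count-head y ys)
  counts⇒↭ (x ∷ xs) ys       same
    with ys₁ , ys₂ , refl ←
           ∈-∃++ (count>0⇒∈ ys (subst (0 <_) (trans (sym (count-head x xs)) (same x)) (s≤s z≤n)))
    = ↭-trans (↭-prep x (counts⇒↭ xs (ys₁ ++ ys₂) same′)) (↭-sym (shift x ys₁ ys₂))
    where
    same′ : ∀ i → count i xs ≡ count i (ys₁ ++ ys₂)
    same′ i = +-cancelˡ-≡ (count i [ x ]) _ _ (begin
      count i [ x ] + count i xs            ≡⟨ count-++ i [ x ] xs ⟨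
      count i (x ∷ xs)                      ≡⟨ same i ⟩
      count i (ys₁ ++ x ∷ ys₂)              ≡⟨ count-↭ i (shift x ys₁ ys₂) ⟩
      count i (x ∷ ys₁ ++ ys₂)              ≡⟨ count-++ i [ x ] (ys₁ ++ ys₂) ⟩
      count i [ x ] + count i (ys₁ ++ ys₂)  ∎)
      where open ≡-Reasoning

count-suc : ∀ {n} (j x : Fin n) → count (suc j) [ suc x ] ≡ count j [ x ]
count-suc j x = by-cases (x ≟ j)
  where
  by-cases : Dec (x ≡ j) → count (suc j) [ suc x ] ≡ count j [ x ]
  by-cases (yes refl) = trans (count-self (suc x)) (sym (count-self x))
  by-cases (no x≢j)   = trans (count-other (x≢j ∘ Fin.suc-injective)) (sym (count-other x≢j))

∑ : ∀ {n} → (Fin n → ℕ) → ℕ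
∑ {zero}  f = 0
∑ {suc n} f = f zero + ∑ (f ∘ suc)

∑-cong : ∀ {n} {f g : Fin n → ℕ} → f ≗ g → ∑ f ≡ ∑ g
∑-cong {zero}  f≗g = refl
∑-cong {suc n} f≗g = cong₂ _+_ (f≗g zero) (∑-cong (f≗g ∘ suc))

∑-+ : ∀ {n} (f g : Fin n → ℕ) → ∑ (λ i → f i + g i) ≡ ∑ f + ∑ g
∑-+ {zero}  f g = refl
∑-+ {suc n} f g = trans (cong (f zero + g zero +_) (∑-+ (f ∘ suc) (g ∘ suc)))
                       (+-exchange (f zero) (g zero) (∑ (f ∘ suc)) (∑ (g ∘ suc)))
  where
  +-exchange : ∀ a b c d → (a + b) + (c + d) ≡ (a + c) + (b + d)
  +-exchange = solve-∀

∑-const : ∀ n c → ∑ {n} (λ _ → c) ≡ n * c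
∑-const zero    c = refl
∑-const (suc n) c = cong (c +_) (∑-const n c)

∑-mono-≤ : ∀ {n} {f g : Fin n → ℕ} → (∀ i → f i ≤ g i) → ∑ f ≤ ∑ g
∑-mono-≤ {zero}  f≤g = z≤n
∑-mono-≤ {suc n} f≤g = +-mono-≤ (f≤g zero) (∑-mono-≤ (f≤g ∘ suc))

∑-mono-≤-tight : ∀ {n} {f g : Fin n → ℕ} → (∀ i → f i ≤ g i) → ∑ g ≤ ∑ f → f ≗ g
∑-mono-≤-tight {suc n} {f} {g} f≤g ∑g≤∑f i with m≤n⇒m<n∨m≡n (f≤g zero)
... | inj₁ f₀<g₀ = contradiction ∑g≤∑f (<⇒≱ (+-mono-<-≤ f₀<g₀ (∑-mono-≤ (f≤g ∘ suc))))
∑-mono-≤-tight f≤g ∑g≤∑f zero    | inj₂ f₀≡g₀ = f₀≡g₀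
∑-mono-≤-tight {f = f} {g} f≤g ∑g≤∑f (suc i) | inj₂ f₀≡g₀ =
  ∑-mono-≤-tight (f≤g ∘ suc) (+-cancelˡ-≤ (g zero) _ _ ∑g≤∑f′) i
  where
  ∑g≤∑f′ : g zero + ∑ (g ∘ suc) ≤ g zero + ∑ (f ∘ suc)
  ∑g≤∑f′ = subst (λ a → g zero + ∑ (g ∘ suc) ≤ a + ∑ (f ∘ suc)) f₀≡g₀ ∑g≤∑f

∑-count-singleton : ∀ {n} (x : Fin n) → ∑ (λ i → count i [ x ]) ≡ 1
∑-count-singleton {suc n} zero = cong₂ _+_ (count-self {suc n} zero)
  (trans (∑-cong {n} (λ j → count-other {i = suc j} {x = zero} λ ())) (trans (∑-const n 0) (*-zeroʳ n)))
∑-count-singleton {suc n} (suc x) = cong₂ _+_ (count-other {i = zero} {x = suc x} λ ())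
  (trans (∑-cong (λ j → count-suc j x)) (∑-count-singleton x))

∑-count : ∀ {n} (xs : List (Fin n)) → ∑ (λ i → count i xs) ≡ length xs
∑-count {n} [] = trans (∑-const n 0) (*-zeroʳ n)
∑-count (x ∷ xs) = begin
  ∑ (λ i → count i (x ∷ xs))                 ≡⟨ ∑-cong (λ i → count-++ i [ x ] xs) ⟩
  ∑ (λ i → count i [ x ] + count i xs)       ≡⟨ ∑-+ (λ i → count i [ x ]) (λ i → count i xs) ⟩
  ∑ (λ i → count i [ x ]) + ∑ (λ i → count i xs) ≡⟨ cong₂ _+_ (∑-count-singleton x) (∑-count xs) ⟩
  suc (length xs)                            ∎
  where open ≡-Reasoning

Equitableᴸ : ∀ {n} → List (Fin n) → Set
Equitableᴸ xs = ∀ i j → count i xs ≤ suc (count j xs)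

Equitableᴸ-resp-↭ : ∀ {n} {xs ys : List (Fin n)} → xs ↭ ys → Equitableᴸ xs → Equitableᴸ ys
Equitableᴸ-resp-↭ p eq i j = subst₂ (λ a b → a ≤ suc b) (count-↭ i p) (count-↭ j p) (eq i j)

IsBlock : ∀ {n} → ℕ → List (Fin n) → Set
IsBlock q t = ∀ i → count i t ≡ q

-- count i [ a ] is the indicator of i ≡ a.
Surplus : ∀ {n} → ℕ → Fin n → List (Fin n) → Set
Surplus q a xs = ∀ i → count i xs ≡ q + count i [ a ]

-- For the most frequent letter a, q < count a xs (otherwise the counts sum to at most qn),
-- so q + [a = i] ≤ count i xs for all i, with equality since both sides sum to qn + 1.
equitable-surplus : ∀ {n} q (xs : List (Fin (suc n))) → length xs ≡ suc (q * suc n) → Equitableᴸ xs →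
                    ∃ λ a → Surplus q a xs
equitable-surplus {n} q xs len equitable =
  a , λ i → sym (∑-mono-≤-tight {f = λ i → q + count i [ a ]} {g = c} lower ∑count≤∑lower i)
  where
  N = suc n
  c : Fin N → ℕ
  c i = count i xs
  a = argmax c zero (allFin N)
  c≤c[a] : ∀ i → c i ≤ c a
  c≤c[a] i = All.lookup (f[xs]≤f[argmax] {f = c} zero (allFin N)) (∈-allFin i)
  ∑c : ∑ c ≡ suc (q * N)
  ∑c = trans (∑-count xs) len
  q<c[a] : q < c a
  q<c[a] = *-cancelˡ-< N q (c a) (begin-strict
    N * q              ≡⟨ *-comm N q ⟩
    q * N              <⟨ ≤-refl ⟩
    suc (q * N)        ≡⟨ ∑c ⟨
    ∑ c                ≤⟨ ∑-mono-≤ c≤c[a] ⟩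
    ∑ {N} (λ _ → c a)  ≡⟨ ∑-const N (c a) ⟩
    N * c a            ∎)
    where open ≤-Reasoning
  lower : ∀ i → q + count i [ a ] ≤ c i
  lower i = by-cases (a ≟ i)
    where
    by-cases : Dec (a ≡ i) → q + count i [ a ] ≤ c i
    by-cases (yes refl) = subst (_≤ c a) (trans (+-comm 1 q) (cong (q +_) (sym (count-self a)))) q<c[a]
    by-cases (no a≢i)   = subst (_≤ c i) (trans (sym (+-identityʳ q)) (cong (q +_) (sym (count-other a≢i))))
                                (m<1+n⇒m≤n (<-≤-trans q<c[a] (equitable a i)))
  ∑count≤∑lower : ∑ c ≤ ∑ (λ i → q + count i [ a ])
  ∑count≤∑lower = ≤-reflexive (begin
    ∑ c                                        ≡⟨ ∑c ⟩
    suc (q * N)                                ≡⟨ cong suc (*-comm q N) ⟩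
    suc (N * q)                                ≡⟨ +-comm 1 (N * q) ⟩
    N * q + 1                                  ≡⟨ cong₂ _+_ (∑-const N q) (∑-count-singleton {N} a) ⟨
    ∑ {N} (λ _ → q) + ∑ (λ i → count i [ a ])  ≡⟨ ∑-+ {N} (λ _ → q) (λ i → count i [ a ]) ⟨
    ∑ (λ i → q + count i [ a ])                ∎)
    where open ≡-Reasoning

-- Sliding through equitable words

module _ {n : ℕ} (q : ℕ) where

  IsBlock-resp-↭ : ∀ {t t′ : List (Fin n)} → t ↭ t′ → IsBlock q t → IsBlock q t′
  IsBlock-resp-↭ p blk i = trans (sym (count-↭ i p)) (blk i)

  IsBlock⇒Equitableᴸ-∷ʳ : ∀ {t : List (Fin n)} → IsBlock q t → ∀ y → Equitableᴸ (t ++ [ y ])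
  IsBlock⇒Equitableᴸ-∷ʳ {t} blk y i j =
    subst₂ (λ a b → a ≤ suc b) (sym (count-t∷ʳy i)) (sym (count-t∷ʳy j)) (begin
      q + count i [ y ]       ≤⟨ +-monoʳ-≤ q (count-singleton≤1 i y) ⟩
      q + 1                   ≡⟨ +-comm q 1 ⟩
      suc q                   ≤⟨ s≤s (m≤m+n q _) ⟩
      suc (q + count j [ y ]) ∎)
    where
    open ≤-Reasoning
    count-t∷ʳy : ∀ k → count k (t ++ [ y ]) ≡ q + count k [ y ]
    count-t∷ʳy k = trans (count-++ k t [ y ]) (cong (_+ count k [ y ]) (blk k))

  -- List form of consecutive equitable words: the tail of one is the init of the next.
  data _⟶_ : List (Fin n) → List (Fin n) → Set where
    slide : ∀ {c w y} → Equitableᴸ (w ++ [ y ]) → (c ∷ w) ⟶ (w ++ [ y ])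

  _⟶*_ : List (Fin n) → List (Fin n) → Set
  _⟶*_ = Star _⟶_

  rotate-step : ∀ {c w} → Equitableᴸ (c ∷ w) → (c ∷ w) ⟶ (w ++ [ c ])
  rotate-step {c} {w} eq = slide (Equitableᴸ-resp-↭ (∷↭∷ʳ c w) eq)

  -- When the dropped letter is the surplus one, any letter may be appended.
  free-step : ∀ {c w} → IsBlock q w → ∀ y → (c ∷ w) ⟶ (w ++ [ y ])
  free-step {c} {w} blk y = slide {c} (IsBlock⇒Equitableᴸ-∷ʳ {w} blk y)

  rotation : ∀ u v → Equitableᴸ (u ++ v) → (u ++ v) ⟶* (v ++ u)
  rotation []      v _  = subst (v ⟶*_) (sym (++-identityʳ v)) ε
  rotation (c ∷ u) v eq = rotate-step {c} {u ++ v} eq ◅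
    subst₂ _⟶*_ (sym (++-assoc u v [ c ])) (++-assoc v [ c ] u) (rotation u (v ++ [ c ]) eq′)
    where
    eq′ : Equitableᴸ (u ++ v ++ [ c ])
    eq′ = Equitableᴸ-resp-↭ (↭-trans (∷↭∷ʳ c (u ++ v)) (↭-reflexive (++-assoc u v [ c ]))) eq

  swapped-rotation : ∀ r (x y : Fin n) V → r ++ x ∷ y ∷ V ↭ y ∷ V ++ x ∷ r
  swapped-rotation r x y V = begin
    r ++ x ∷ y ∷ V     ↭⟨ ++-comm r (x ∷ y ∷ V) ⟩
    x ∷ y ∷ V ++ r     ↭⟨ ↭-swap x y ↭-refl ⟩
    y ∷ x ∷ V ++ r     ↭⟨ ↭-prep y (shift x V r) ⟨
    y ∷ V ++ x ∷ r     ∎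
    where open PermutationReasoning

  -- Append x while dropping the surplus a; after rotating r the dropped x, then y, are surplus.
  adjacent-swap : ∀ a r x y V → IsBlock q (r ++ x ∷ y ∷ V) → (a ∷ r ++ x ∷ y ∷ V) ⟶* (x ∷ r ++ y ∷ x ∷ V)
  adjacent-swap a r x y V blk = begin
    a ∷ r ++ x ∷ y ∷ V                ⟶⟨ free-step {a} {r ++ x ∷ y ∷ V} blk x ⟩
    (r ++ x ∷ y ∷ V) ++ [ x ]         ≡⟨ ++-assoc r (x ∷ y ∷ V) [ x ] ⟩
    r ++ x ∷ y ∷ V ++ [ x ]           ⟶*⟨ rotation r (x ∷ y ∷ V ++ [ x ]) eq₁ ⟩
    x ∷ y ∷ (V ++ [ x ]) ++ r         ≡⟨ cong (λ t → x ∷ y ∷ t) (++-assoc V [ x ] r) ⟩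
    x ∷ y ∷ V ++ x ∷ r                ⟶⟨ free-step {x} {y ∷ V ++ x ∷ r} blk₂ y ⟩
    y ∷ (V ++ x ∷ r) ++ [ y ]         ⟶⟨ free-step {y} {(V ++ x ∷ r) ++ [ y ]} blk₃ x ⟩
    ((V ++ x ∷ r) ++ [ y ]) ++ [ x ]  ≡⟨ tidy ⟩
    V ++ x ∷ r ++ y ∷ x ∷ []          ⟶*⟨ rotation V (x ∷ r ++ y ∷ x ∷ []) eq₂ ⟩
    (x ∷ r ++ y ∷ x ∷ []) ++ V        ≡⟨ cong (x ∷_) (++-assoc r (y ∷ x ∷ []) V) ⟩
    x ∷ r ++ y ∷ x ∷ V                ∎
    where
    open StarReasoning _⟶_
    eq₁ : Equitableᴸ (r ++ x ∷ y ∷ V ++ [ x ])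
    eq₁ = subst Equitableᴸ (++-assoc r (x ∷ y ∷ V) [ x ]) (IsBlock⇒Equitableᴸ-∷ʳ {r ++ x ∷ y ∷ V} blk x)
    blk₂ : IsBlock q (y ∷ V ++ x ∷ r)
    blk₂ = IsBlock-resp-↭ (swapped-rotation r x y V) blk
    blk₃ : IsBlock q ((V ++ x ∷ r) ++ [ y ])
    blk₃ = IsBlock-resp-↭ (∷↭∷ʳ y (V ++ x ∷ r)) blk₂
    tidy : ((V ++ x ∷ r) ++ [ y ]) ++ [ x ] ≡ V ++ x ∷ r ++ y ∷ x ∷ []
    tidy = trans (++-assoc (V ++ x ∷ r) [ y ] [ x ]) (++-assoc V (x ∷ r) (y ∷ x ∷ []))
    eq₂ : Equitableᴸ (V ++ x ∷ r ++ y ∷ x ∷ [])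
    eq₂ = subst Equitableᴸ tidy (IsBlock⇒Equitableᴸ-∷ʳ {(V ++ x ∷ r) ++ [ y ]} blk₃ x)

  rearrange : ∀ r {u u′} → u ↭ u′ → IsBlock q (r ++ u) → ∀ a → ∃ λ a′ → (a ∷ r ++ u) ⟶* (a′ ∷ r ++ u′)
  rearrange r Perm.refl blk a = a , ε
  rearrange r (Perm.prep {xs = u} {ys = u′} x p) blk a
    with a′ , steps ← rearrange (r ++ [ x ]) p (subst (IsBlock q) (sym (++-assoc r [ x ] u)) blk) a
    = a′ , subst₂ (λ s t → (a ∷ s) ⟶* (a′ ∷ t)) (++-assoc r [ x ] u) (++-assoc r [ x ] u′) steps
  rearrange r (Perm.swap {xs = u} {ys = u′} x y p) blk a
    with a′ , steps ← rearrange (r ++ x ∷ y ∷ []) p (subst (IsBlock q) (sym (++-assoc r (x ∷ y ∷ []) u)) blk) a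
    = x , subst₂ (λ s t → (a ∷ s) ⟶* (a′ ∷ t)) (++-assoc r (x ∷ y ∷ []) u) (++-assoc r (x ∷ y ∷ []) u′) steps
          ◅◅ adjacent-swap a′ r x y u′ (IsBlock-resp-↭ (++⁺ˡ r (↭-prep x (↭-prep y p))) blk)
  rearrange r (Perm.trans p p′) blk a
    with a′ , steps ← rearrange r p blk a
    with a″ , steps′ ← rearrange r p′ (IsBlock-resp-↭ (++⁺ˡ r p) blk) a′
    = a″ , steps ◅◅ steps′

  Surplus⇒∈ : ∀ {xs : List (Fin n)} {a} → Surplus q a xs → a ∈ xs
  Surplus⇒∈ {xs} {a} profile = count>0⇒∈ xs (subst (0 <_) (sym (trans (profile a) (cong (q +_) (count-self a)))) 0<q+1)
    where
    0<q+1 : 0 < q + 1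
    0<q+1 = subst (0 <_) (+-comm 1 q) (s≤s z≤n)

  surplus-split : ∀ {xs : List (Fin n)} {a} → Surplus q a xs →
                  ∃ λ e₁ → ∃ λ e₂ → xs ≡ e₁ ++ a ∷ e₂ × IsBlock q (e₂ ++ e₁)
  surplus-split {xs} {a} profile
    with e₁ , e₂ , refl ← ∈-∃++ (Surplus⇒∈ {xs} {a} profile)
    = e₁ , e₂ , refl , λ i → +-cancelʳ-≡ (count i [ a ]) _ _ (begin
        count i (e₂ ++ e₁) + count i [ a ]  ≡⟨ +-comm _ (count i [ a ]) ⟩
        count i [ a ] + count i (e₂ ++ e₁)  ≡⟨ count-++ i [ a ] (e₂ ++ e₁) ⟨
        count i (a ∷ e₂ ++ e₁)              ≡⟨ count-↭ i (++-comm e₁ (a ∷ e₂)) ⟨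
        count i (e₁ ++ a ∷ e₂)              ≡⟨ profile i ⟩
        q + count i [ a ]                   ∎)
    where
    open ≡-Reasoning

  to-surplus-front : ∀ {xs : List (Fin n)} {a} → Equitableᴸ xs → Surplus q a xs →
                     ∃ λ t → IsBlock q t × xs ⟶* (a ∷ t)
  to-surplus-front {xs} {a} eq profile with e₁ , e₂ , refl , blk ← surplus-split {xs} {a} profile =
    e₂ ++ e₁ , blk , rotation e₁ (a ∷ e₂) eq

  from-surplus-front : ∀ {ys : List (Fin n)} {b} → Surplus q b ys →
                       ∃ λ t → IsBlock q t × ∀ a → (a ∷ t) ⟶* ys
  from-surplus-front {ys} {b} profile with f₁ , f₂ , refl , blk ← surplus-split {ys} {b} profile =
    f₂ ++ f₁ , blk , λ a → begin
      a ∷ f₂ ++ f₁         ⟶⟨ free-step {a} {f₂ ++ f₁} blk b ⟩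
      (f₂ ++ f₁) ++ [ b ]  ≡⟨ ++-assoc f₂ f₁ [ b ] ⟩
      f₂ ++ f₁ ++ [ b ]    ⟶*⟨ rotation f₂ (f₁ ++ [ b ]) equitable ⟩
      (f₁ ++ [ b ]) ++ f₂  ≡⟨ ++-assoc f₁ [ b ] f₂ ⟩
      f₁ ++ b ∷ f₂         ∎
    where
    open StarReasoning _⟶_
    equitable : Equitableᴸ (f₂ ++ f₁ ++ [ b ])
    equitable = subst Equitableᴸ (++-assoc f₂ f₁ [ b ]) (IsBlock⇒Equitableᴸ-∷ʳ {f₂ ++ f₁} blk b)

connected : ∀ {n} q {xs ys : List (Fin (suc n))} → length xs ≡ suc (q * suc n) → length ys ≡ suc (q * suc n) →
            Equitableᴸ xs → Equitableᴸ ys → _⟶*_ q xs ys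
connected q {xs} {ys} len-xs len-ys eq-xs eq-ys =
  via-surplus (equitable-surplus q xs len-xs eq-xs) (equitable-surplus q ys len-ys eq-ys)
  where
  via-surplus : (∃ λ a → Surplus q a xs) → (∃ λ b → Surplus q b ys) → _⟶*_ q xs ys
  via-surplus (a , profile-xs) (b , profile-ys) =
    let t , blk-t , xs⟶*a∷t = to-surplus-front q {xs} {a} eq-xs profile-xs
        t′ , blk-t′ , a′∷t′⟶*ys = from-surplus-front q {ys} {b} profile-ys
        a′ , a∷t⟶*a′∷t′ = rearrange q [] (counts⇒↭ t t′ (λ i → trans (blk-t i) (sym (blk-t′ i)))) blk-t a
    in xs⟶*a∷t ◅◅ a∷t⟶*a′∷t′ ◅◅ a′∷t′⟶*ys a′

-- The graph of equitable words

words : ∀ {n} m → List (Word m n)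
words zero        = [ [] ]
words {n} (suc m) = cartesianProductWith _∷_ (allFin n) (words m)

∈-words : ∀ {n m} (w : Word m n) → w ∈ words m
∈-words []      = here refl
∈-words (x ∷ w) = ∈-cartesianProductWith⁺ _∷_ (∈-allFin x) (∈-words w)

words-unique : ∀ {n} m → Unique (words {n} m)
words-unique zero    = All.[] ∷ []
words-unique (suc m) = Unique.cartesianProductWith⁺ _∷_ ∷-injective (Unique.allFin⁺ _) (words-unique m)

blocks : ∀ {n} q → Vec (Fin n) (q * n)
blocks zero        = []
blocks {n} (suc q) = Vec.allFin n Vec.++ blocks q

count-allFin : ∀ {n} (i : Fin n) → count i (toList (Vec.allFin n)) ≡ 1
count-allFin {n} i = trans (count-tabulate id) (trans (∑-cong (λ j → count-singleton-sym i j)) (∑-count-singleton i))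
  where
  count-tabulate : ∀ {m} (f : Fin m → Fin n) → count i (toList (tabulate f)) ≡ ∑ (λ j → count i [ f j ])
  count-tabulate {zero}  f = refl
  count-tabulate {suc m} f = trans (count-++ i [ f zero ] _) (cong (count i [ f zero ] +_) (count-tabulate (f ∘ suc)))

count-blocks : ∀ {n} q (i : Fin n) → count i (toList (blocks q)) ≡ q
count-blocks zero        i = refl
count-blocks {n} (suc q) i = trans (cong (count i) (toList-++ (Vec.allFin n) (blocks q)))
  (trans (count-++ i (toList (Vec.allFin n)) (toList (blocks q))) (cong₂ _+_ (count-allFin i) (count-blocks q i)))

equitable? : ∀ {m n} (w : Word m n) → Dec (Equitable w)
equitable? w = all? λ i → all? λ j → count i (toList w) ≤? suc (count j (toList w))

rotate-right : ∀ {A : Set} {k} → Vec A (suc k) → Vec A (suc k)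
rotate-right (x ∷ v) = v ∷ʳ x

rotate-right-↭ : ∀ {A : Set} {k} (w : Vec A (suc k)) → toList (rotate-right w) ↭ toList w
rotate-right-↭ (x ∷ v) = ↭-trans (↭-reflexive (toList-∷ʳ x v)) (↭-sym (∷↭∷ʳ x (toList v)))

rotate-right-injective : ∀ {A : Set} {k} {w w′ : Vec A (suc k)} → rotate-right w ≡ rotate-right w′ → w ≡ w′
rotate-right-injective {w = x ∷ v} {x′ ∷ v′} eq with refl , refl ← ∷ʳ-injective v v′ eq = refl

rotate-right-surjective : ∀ {A : Set} {k} (w : Vec A (suc k)) → rotate-right (last w ∷ init w) ≡ w
rotate-right-surjective w = sym (proj₂ (proj₂ (initLast w)))

Equitable-rotate-right : ∀ {k n} (w : Word (suc k) n) → Equitable w → Equitable (rotate-right w)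
Equitable-rotate-right w = Equitableᴸ-resp-↭ (↭-sym (rotate-right-↭ w))

Equitable-rotate-right⁻ : ∀ {k n} (w : Word (suc k) n) → Equitable (rotate-right w) → Equitable w
Equitable-rotate-right⁻ w = Equitableᴸ-resp-↭ (rotate-right-↭ w)

toList-injective′ : ∀ {A : Set} {k} {w w′ : Vec A k} → toList w ≡ toList w′ → w ≡ w′
toList-injective′ {w = w} {w′} eq = trans (sym (cast-is-id refl w)) (toList-injective refl w w′ eq)

module EquitableWordGraph (n′ q : ℕ) where

  n = suc n′
  k = q * n

  Edge : Set
  Edge = Word (suc k) n

  open Eulerian {Edge} {Vec (Fin n) k} (≡-decᵛ _≟_) init tail

  equitable-words : List Edge
  equitable-words = filter equitable? (words (suc k))

  ∈⇒equitable : ∀ {w} → w ∈ equitable-words → Equitable w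
  ∈⇒equitable w∈ = proj₂ (∈-filter⁻ equitable? {xs = words (suc k)} w∈)

  equitable⇒∈ : ∀ {w} → Equitable w → w ∈ equitable-words
  equitable⇒∈ {w} eq = ∈-filter⁺ equitable? (∈-words w) eq

  equitable-words-unique : Unique equitable-words
  equitable-words-unique = Unique.filter⁺ equitable? (words-unique (suc k))

  -- rotate-right is a bijection of the edge set with init ∘ rotate-right = tail.
  equitable-words-balanced : Balanced equitable-words
  equitable-words-balanced = begin
    map init equitable-words                       ↭⟨ map⁺ init rotated ⟨
    map init (map rotate-right equitable-words)    ≡⟨ map-∘ equitable-words ⟨
    map (init ∘ rotate-right) equitable-words      ≡⟨ map-cong init∘rotate-right equitable-words ⟩
    map tail equitable-words                       ∎
    where
    open PermutationReasoning
    init∘rotate-right : ∀ (w : Edge) → init (rotate-right w) ≡ tail w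
    init∘rotate-right (x ∷ v) = init-∷ʳ x v
    rotated : map rotate-right equitable-words ↭ equitable-words
    rotated = Unique-⊆-antisym⇒↭ (Unique.map⁺ rotate-right-injective equitable-words-unique) equitable-words-unique
                into onto
      where
      into : ∀ {w} → w ∈ map rotate-right equitable-words → w ∈ equitable-words
      into w∈ with w , w∈′ , refl ← ∈-map⁻ rotate-right w∈ =
        equitable⇒∈ (Equitable-rotate-right w (∈⇒equitable w∈′))
      onto : ∀ {w} → w ∈ equitable-words → w ∈ map rotate-right equitable-words
      onto {w} w∈ = subst (_∈ map rotate-right equitable-words) (rotate-right-surjective w)
        (∈-map⁺ rotate-right (equitable⇒∈ (Equitable-rotate-right⁻ (last w ∷ init w)
          (subst Equitable (sym (rotate-right-surjective w)) (∈⇒equitable w∈)))))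

  e₀ : Edge
  e₀ = zero ∷ blocks q

  e₀-equitable : Equitable e₀
  e₀-equitable = Equitableᴸ-resp-↭ (↭-sym (∷↭∷ʳ zero (toList (blocks q))))
                   (IsBlock⇒Equitableᴸ-∷ʳ q {toList (blocks q)} (count-blocks q) zero)

  e₀∈ : e₀ ∈ equitable-words
  e₀∈ = equitable⇒∈ {e₀} e₀-equitable

  slides⇒path : ∀ {xs ys} → _⟶*_ q xs ys → ∀ {a b : Edge} → toList a ≡ xs → toList b ≡ ys →
                Star (Adjacent equitable-words) a b
  slides⇒path ε                             a≡ b≡ = subst (Star _ _) (toList-injective′ (trans a≡ (sym b≡))) ε
  slides⇒path (slide {y = y} eq ◅ slides) {x ∷ v} refl b≡ =
    (sym (init-∷ʳ y v) , equitable⇒∈ (subst Equitableᴸ (sym (toList-∷ʳ y v)) eq))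
    ◅ slides⇒path slides (toList-∷ʳ y v) b≡

  connectivity : ∀ {e} → e ∈ equitable-words → Star (Adjacent equitable-words) e₀ e
  connectivity {e} e∈ =
    slides⇒path (connected q (length-toList e₀) (length-toList e) e₀-equitable (∈⇒equitable e∈)) refl refl

  equitable-UCycle : HasUCycle (suc k) Equitable
  equitable-UCycle =
    from-circuit (eulerian-circuit equitable-words equitable-words-unique equitable-words-balanced connectivity e₀∈)
    where
    from-circuit : (∃ λ w → Σ (Trail w w) λ T → edges T ↭ equitable-words) → HasUCycle (suc k) Equitable
    from-circuit (_ , [] , perm) = contradiction (∈-resp-↭ (↭-sym perm) e₀∈) λ ()
    from-circuit (_ , C@(step e p T) , perm) =
      _ , head ∘ walk , closed-walk⇒UCycle walk (closed-trail-adjacent p T) walk-equitable walk-injective walk-onto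
      where
      walk = lookup (edges C)
      walk-equitable : ∀ i → Equitable (walk i)
      walk-equitable i = ∈⇒equitable (∈-resp-↭ perm (∈-lookup i))
      walk-injective : ∀ i j → walk i ≡ walk j → i ≡ j
      walk-injective = lookup-injective (Unique-resp-↭ (↭-sym perm) equitable-words-unique)
      walk-onto : ∀ w → Equitable w → ∃ λ i → walk i ≡ w
      walk-onto w eq = index w∈C , sym (lookup-index w∈C)
        where
        w∈C = ∈-resp-↭ (↭-sym perm) (equitable⇒∈ eq)

m≡1[n]⇒m≡1+q*n : ∀ n′ m → m ≥ 1 → m % suc n′ ≡ 1 % suc n′ → ∃ λ q → m ≡ suc (q * suc n′)
m≡1[n]⇒m≡1+q*n zero     (suc m′) _ _   = m′ , cong suc (sym (*-identityʳ m′))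
m≡1[n]⇒m≡1+q*n (suc n″) m        _ m≡1 =
  m / suc (suc n″) , trans (m≡m%n+[m/n]*n m (suc (suc n″))) (cong (_+ m / suc (suc n″) * suc (suc n″)) m≡1)

theorem7 : (n m : ℕ) → .{{_ : NonZero n}} → n ≥ 1 → m ≥ 1 → m % n ≡ 1 % n →
    HasUCycle {n} m Equitable
theorem7 (suc n′) m _ m≥1 m≡1 with q , refl ← m≡1[n]⇒m≡1+q*n n′ m m≥1 m≡1 =
  EquitableWordGraph.equitable-UCycle n′ q
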